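{- For any odd prime $p$ and any non-negative integer $k$, \[ C^{(-k-1)}_{p-2}\equiv \begin{cases} 0 \pmod{p} & \text{if } k\not\equiv 0 \pmod{p-1},\\ 1\pmod{p} & \text{if } k\equiv 0\pmod{p-1}.\end{cases} \]
   Context: For any integer $k$, let $\mathrm{Li}_k(t)=\sum_{n\geq 1} t^n/n^k$ (for $k\le 0$ this is a rational function of $t$). The poly-Bernoulli numbers of type $C$, $C^{(k)}_n$ ($n\ge 0$), are defined by \[ \frac{\mathrm{Li}_{k}(1-e^{ -t})}{e^{t}-1}=\sum_{n=0}^{\infty}C^{(k)}_{n}\frac{t^n}{n!}. \] For negative upper index these are integers. -}

module Defs where

open import Data.Nat as ℕ using (ℕ; zero; suc; _∸_; _≤ᵇ_; _!)
open import Data.Nat.Properties using (_!≢0)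
open import Data.Integer as ℤ using (ℤ; +_; -[1+_])
open import Data.Rational using (ℚ; _+_; _*_; _-_; -_; _/_; 0ℚ; 1ℚ)
open import Data.Bool using (if_then_else_)

-- Formal power series over ℚ, given by their ordinary coefficient sequences:
-- a series f stands for Σ_n f n · t^n.
Series : Set
Series = ℕ → ℚ

sumTo : ℕ → (ℕ → ℚ) → ℚ
sumTo zero    f = f 0
sumTo (suc n) f = sumTo n f + f (suc n)

_⋆_ : Series → Series → Series
(f ⋆ g) n = sumTo n (λ i → f i * g (n ∸ i))

pow : Series → ℕ → Series
pow g zero    zero    = 1ℚ
pow g zero    (suc n) = 0ℚ
pow g (suc j) = g ⋆ pow g j

-- composition a(g(t)) = Σ_j a_j g(t)^j, valid when g has zero constant term
-- (then only j ≤ n contributes to the coefficient of t^n)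
compose : Series → Series → Series
compose a g n = sumTo n (λ j → a j * pow g j n)

ℕtoℚ : ℕ → ℚ
ℕtoℚ n = + n / 1

expNeg : Series
expNeg n = (sgn n / (n !)) {{n !≢0}}
  where
  sgn : ℕ → ℤ
  sgn zero = + 1
  sgn (suc zero) = -[1+ 0 ]
  sgn (suc (suc m)) = sgn m

oneMinusExpNeg : Series
oneMinusExpNeg zero    = 0ℚ
oneMinusExpNeg (suc n) = - expNeg (suc n)

-- Li_{-m}(x) = Σ_{j ≥ 1} j^m x^j  as a formal power series in x
LiNeg : ℕ → Series
LiNeg m zero    = 0ℚ
LiNeg m (suc j) = ℕtoℚ (suc j ℕ.^ m)

LiNegComp : ℕ → Series
LiNegComp m = compose (LiNeg m) oneMinusExpNeg

expm1OverT : Series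
expm1OverT n = (+ 1 / (suc n !)) {{suc n !≢0}}

-- The quotient H = Li_{-m}(1-e^{-t}) / (e^t - 1) = (Li_{-m}(1-e^{-t})/t) / ((e^t-1)/t),
-- computed by the standard recursion for dividing by a series with
-- constant term 1:  h_n = F_{n+1} - Σ_{j=1}^{n} E_j h_{n-j}
-- (F = Li_{-m}(1-e^{-t}), whose constant term is 0, E = (e^t-1)/t).
-- quotPrefix m n i = h_i  for i ≤ n.
quotPrefix : ℕ → ℕ → ℕ → ℚ
quotPrefix m zero    i = LiNegComp m 1
quotPrefix m (suc n) i =
  if i ≤ᵇ n then quotPrefix m n i
  else (LiNegComp m (suc (suc n))
         - sumTo n (λ j → expm1OverT (suc j) * quotPrefix m n (n ∸ j)))

quot : ℕ → Series
quot m n = quotPrefix m n n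

-- Poly-Bernoulli numbers of type C with negative upper index:
-- polyBernC⁻ m n = C_n^{(-m)}, where
--   Li_{-m}(1 - e^{-t}) / (e^t - 1) = Σ_n C_n^{(-m)} t^n / n!
polyBernC⁻ : ℕ → ℕ → ℚ
polyBernC⁻ m n = ℕtoℚ (n !) * quot m n

module Submission where

-- Integer sequences u are read as exponential generating functions Σ u n tⁿ/n!, multiplied by
-- binomial convolution ⊛; exp a = (aⁿ)ₙ is e^{at}.  Since (1 - e^{-t})ʲ = Σᵢ (-1)ⁱ C(j,i) e^{-it}
-- and (eᵗ - 1)·e^{-t}(1 - e^{-t})ʲ = (1 - e^{-t})ʲ⁺¹, dividing Li_{-m}(1 - e^{-t}) = Σⱼ jᵐ (1 - e^{-t})ʲ
-- by eᵗ - 1 gives the integer formula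
--   C_n^{(-m)} = Σ_{j≤n} (j+1)ᵐ Σ_{i≤j} (-1)ⁱ C(j,i) (-1-i)ⁿ.
-- For n = p - 2, absorption (j+1) C(j,i) = (i+1) C(j+1,i+1) and Fermat's little theorem collapse the
-- inner sum times j+1 to (-1)ⁿ, so C^{(-k-1)}_{p-2} ≡ (-1)ⁿ Σ_{a=1}^{p-1} aᵏ (mod p).  The power sums
-- Sᵣ = Σ_{a<p} aʳ satisfy Σ_{i≤r} C(r+1,i) Sᵢ = p^{r+1}, so Sᵣ ≡ 0 for r < p - 1 by induction; hence the
-- sum vanishes unless p - 1 ∣ k, and then it is p - 1 ≡ -1, leaving (-1)^{p-1} ≡ (p-1)^{p-1} ≡ 1.

open import Defs

open import Data.Bool using (true; false; T)
open import Data.Empty using (⊥-elim)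
open import Data.Fin using (toℕ)
open import Data.Maybe using (nothing)
open import Data.Product using (∃-syntax; _×_; _,_)
open import Data.Sum using (inj₁; inj₂)
open import Data.Unit using (tt)
open import Function using (_∘_)
open import Level using (0ℓ)
open import Relation.Binary.Bundles using (Setoid)
open import Relation.Binary.PropositionalEquality
import Relation.Binary.Reasoning.Setoid as SetoidReasoning
open import Relation.Nullary using (¬_; yes; no)

open import Data.Nat as ℕ using (ℕ; zero; suc; _∸_; _<_; _≤_; z≤n; s≤s; _!)
open import Data.Nat.Properties as ℕ using (_!≢0; _!*_!≢0)
import Data.Nat.DivMod as ℕ
import Data.Nat.Tactic.RingSolver as ℕ-Solver
open import Data.Nat.Combinatorics
  using (_C_; nCk≡n!/k![n-k]!; k![n∸k]!∣n!; k>n⇒nCk≡0; nCk+nC[k+1]≡[n+1]C[k+1]; nCn≡1; nC1≡n; nCk≡nC[n∸k])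
open import Data.Nat.Divisibility using (_∣_; divides; >⇒∤)
import Data.Nat.Divisibility as ℕD
open import Data.Nat.Induction using (<-rec)
open import Data.Nat.Primality using (Prime; euclidsLemma; ¬prime[0]; ¬prime[1])

open import Data.Integer as ℤ
  using (ℤ; +_; 0ℤ; 1ℤ; -1ℤ; _+_; _*_; -_; _-_; _^_; +-0-rawMonoid; +-*-rawSemiring)
open import Data.Integer.Properties as ℤ using (pos-+; pos-*)
import Data.Integer.Divisibility as ℤD
import Data.Integer.Divisibility.Signed as Signed
open import Data.Integer.Tactic.RingSolver using (solve-∀)

open import Data.Rational as ℚ using (ℚ; _/_; 0ℚ; 1ℚ)
import Data.Rational.Properties as ℚ
import Data.Rational.Unnormalised as ℚᵘ
import Data.Rational.Unnormalised.Properties as ℚᵘ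
import Tactic.RingSolver as ℚ-Solver
import Tactic.RingSolver.Core.AlmostCommutativeRing as ACR

open import Algebra.Properties.AbelianGroup ℤ.+-0-abelianGroup using (⁻¹-anti-homo‿-)
open import Algebra.Properties.CommutativeSemigroup ℤ.+-commutativeSemigroup using (interchange)
open import Algebra.Properties.Ring ℤ.+-*-ring using (x[y-z]≈xy-xz; [y-z]x≈yx-zx)
import Algebra.Definitions.RawMonoid +-0-rawMonoid as Additive
import Algebra.Definitions.RawSemiring +-*-rawSemiring as Semiring
import Algebra.Properties.CommutativeSemiring.Binomial ℤ.+-*-commutativeSemiring as Binomial
import Algebra.Properties.CommutativeSemiring.Exp ℤ.+-*-commutativeSemiring as Exp

∑ : ℕ → (ℕ → ℤ) → ℤ
∑ zero    f = 0ℤ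
∑ (suc n) f = ∑ n f + f n

infixl 10 ∑
syntax ∑ n (λ i → x) = ∑[ i < n ] x

∑-cong : ∀ n {f g : ℕ → ℤ} → (∀ i → i < n → f i ≡ g i) → ∑ n f ≡ ∑ n g
∑-cong zero    f≡g = refl
∑-cong (suc n) f≡g = cong₂ _+_ (∑-cong n (λ i i<n → f≡g i (ℕ.m<n⇒m<1+n i<n))) (f≡g n ℕ.≤-refl)

∑-head : ∀ n (f : ℕ → ℤ) → ∑ (suc n) f ≡ f 0 + ∑ n (f ∘ suc)
∑-head zero    f = ℤ.+-comm 0ℤ (f 0)
∑-head (suc n) f = trans (cong (_+ f (suc n)) (∑-head n f)) (ℤ.+-assoc (f 0) _ _)

∑-zero : ∀ n {f : ℕ → ℤ} → (∀ i → i < n → f i ≡ 0ℤ) → ∑ n f ≡ 0ℤ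
∑-zero n f≡0 = trans (∑-cong n f≡0) (∑0 n)
  where
  ∑0 : ∀ n → ∑[ i < n ] 0ℤ ≡ 0ℤ
  ∑0 zero    = refl
  ∑0 (suc n) = cong (_+ 0ℤ) (∑0 n)

∑-truncate : ∀ {N M} (f : ℕ → ℤ) → N ≤ M → (∀ j → N ≤ j → f j ≡ 0ℤ) → ∑ M f ≡ ∑ N f
∑-truncate {M = zero}  f z≤n   _ = refl
∑-truncate {M = suc M} f N≤1+M f≡0 with ℕ.m≤n⇒m<n∨m≡n N≤1+M
... | inj₂ refl       = refl
... | inj₁ (s≤s N≤M) =
  trans (cong₂ _+_ (∑-truncate f N≤M f≡0) (f≡0 M N≤M)) (ℤ.+-identityʳ _)

∑-distrib-+ : ∀ n (f g : ℕ → ℤ) → ∑[ i < n ] (f i + g i) ≡ ∑ n f + ∑ n g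
∑-distrib-+ zero    f g = refl
∑-distrib-+ (suc n) f g =
  trans (cong (_+ (f n + g n)) (∑-distrib-+ n f g)) (interchange (∑ n f) (∑ n g) (f n) (g n))

∑-neg : ∀ n (f : ℕ → ℤ) → - ∑ n f ≡ ∑[ i < n ] (- f i)
∑-neg zero    f = refl
∑-neg (suc n) f = trans (ℤ.neg-distrib-+ (∑ n f) (f n)) (cong (_+ - f n) (∑-neg n f))

∑-distrib-minus : ∀ n (f g : ℕ → ℤ) → ∑[ i < n ] (f i - g i) ≡ ∑ n f - ∑ n g
∑-distrib-minus n f g =
  trans (∑-distrib-+ n f (-_ ∘ g)) (cong (λ s → ∑ n f + s) (sym (∑-neg n g)))

*-distribˡ-∑ : ∀ n c (f : ℕ → ℤ) → c * ∑ n f ≡ ∑[ i < n ] (c * f i)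
*-distribˡ-∑ zero    c f = ℤ.*-zeroʳ c
*-distribˡ-∑ (suc n) c f =
  trans (ℤ.*-distribˡ-+ c (∑ n f) (f n)) (cong (_+ c * f n) (*-distribˡ-∑ n c f))

∑-comm : ∀ n m (f : ℕ → ℕ → ℤ) → ∑[ i < n ] ∑[ j < m ] f i j ≡ ∑[ j < m ] ∑[ i < n ] f i j
∑-comm zero    m f = sym (∑-zero m (λ _ _ → refl))
∑-comm (suc n) m f =
  trans (cong (_+ ∑ m (f n)) (∑-comm n m f)) (sym (∑-distrib-+ m (λ j → ∑[ i < n ] f i j) (f n)))

private
  ∑≡sum : ∀ n (f : ℕ → ℤ) → ∑ n f ≡ Additive.sum (f ∘ toℕ {n})
  ∑≡sum zero    f = refl
  ∑≡sum (suc n) f = trans (∑-head n f) (cong (λ s → f 0 + s) (∑≡sum n (f ∘ suc)))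

  ×≡* : ∀ n x → n Additive.× x ≡ + n * x
  ×≡* zero    x = sym (ℤ.*-zeroˡ x)
  ×≡* (suc n) x = begin
    x + n Additive.× x ≡⟨ cong (λ s → x + s) (×≡* n x) ⟩
    x + + n * x        ≡⟨ cong (_+ + n * x) (sym (ℤ.*-identityˡ x)) ⟩
    1ℤ * x + + n * x   ≡⟨ sym (ℤ.*-distribʳ-+ x 1ℤ (+ n)) ⟩
    + suc n * x        ∎
    where open ≡-Reasoning

  ^≡^ : ∀ x n → x Semiring.^ n ≡ x ^ n
  ^≡^ x zero    = refl
  ^≡^ x (suc n) = cong (x *_) (^≡^ x n)

binomial-theorem : ∀ n x y → (x + y) ^ n ≡ ∑[ i < suc n ] (+ (n C i) * (x ^ i * y ^ (n ∸ i)))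
binomial-theorem n x y = begin
  (x + y) ^ n
    ≡⟨ sym (^≡^ (x + y) n) ⟩
  (x + y) Semiring.^ n
    ≡⟨ Binomial.theorem n x y ⟩
  Additive.sum (term ∘ toℕ {suc n})
    ≡⟨ sym (∑≡sum (suc n) term) ⟩
  ∑ (suc n) term
    ≡⟨ ∑-cong (suc n) (λ i _ → trans (×≡* (n C i) _)
         (cong₂ (λ a b → + (n C i) * (a * b)) (^≡^ x i) (^≡^ y (n ∸ i)))) ⟩
  ∑[ i < suc n ] (+ (n C i) * (x ^ i * y ^ (n ∸ i))) ∎
  where
  open ≡-Reasoning
  term : ℕ → ℤ
  term i = (n C i) Additive.× (x Semiring.^ i * y Semiring.^ (n ∸ i))

pos-^ : ∀ a k → + (a ℕ.^ k) ≡ (+ a) ^ k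
pos-^ a zero    = refl
pos-^ a (suc k) = trans (pos-* a (a ℕ.^ k)) (cong (+ a *_) (pos-^ a k))

^-distrib-* : ∀ x y n → (x * y) ^ n ≡ x ^ n * y ^ n
^-distrib-* x y n =
  trans (sym (^≡^ (x * y) n)) (trans (Exp.^-distrib-* x y n) (cong₂ _*_ (^≡^ x n) (^≡^ y n)))

nCk*k![n∸k]!≡n! : ∀ {n k} → k ≤ n → (n C k) ℕ.* (k ! ℕ.* (n ∸ k) !) ≡ n !
nCk*k![n∸k]!≡n! {n} {k} k≤n =
  trans (cong (ℕ._* (k ! ℕ.* (n ∸ k) !)) (nCk≡n!/k![n-k]! k≤n))
        (ℕ.m/n*n≡m {{k !* (n ∸ k) !≢0}} (k![n∸k]!∣n! k≤n))

[1+n]*nCk≡[1+k]*[1+n]C[1+k] : ∀ n k → suc n ℕ.* (n C k) ≡ suc k ℕ.* (suc n C suc k)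
[1+n]*nCk≡[1+k]*[1+n]C[1+k] n k with k ℕ.≤? n
... | yes k≤n = ℕ.*-cancelʳ-≡ _ _ (k ! ℕ.* (n ∸ k) !) {{k !* (n ∸ k) !≢0}} (begin
  suc n ℕ.* (n C k) ℕ.* (k ! ℕ.* (n ∸ k) !)
    ≡⟨ ℕ.*-assoc (suc n) (n C k) _ ⟩
  suc n ℕ.* ((n C k) ℕ.* (k ! ℕ.* (n ∸ k) !))
    ≡⟨ cong (suc n ℕ.*_) (nCk*k![n∸k]!≡n! k≤n) ⟩
  suc n !
    ≡⟨ sym (nCk*k![n∸k]!≡n! (s≤s k≤n)) ⟩
  (suc n C suc k) ℕ.* (suc k ℕ.* k ! ℕ.* (n ∸ k) !)
    ≡⟨ rearrange (suc n C suc k) (suc k) (k !) ((n ∸ k) !) ⟩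
  suc k ℕ.* (suc n C suc k) ℕ.* (k ! ℕ.* (n ∸ k) !) ∎)
  where
  open ≡-Reasoning
  rearrange : ∀ c s a b → c ℕ.* (s ℕ.* a ℕ.* b) ≡ s ℕ.* c ℕ.* (a ℕ.* b)
  rearrange = ℕ-Solver.solve-∀
... | no k≰n = begin
  suc n ℕ.* (n C k)             ≡⟨ cong (suc n ℕ.*_) (k>n⇒nCk≡0 (ℕ.≰⇒> k≰n)) ⟩
  suc n ℕ.* 0                   ≡⟨ ℕ.*-zeroʳ (suc n) ⟩
  0                             ≡⟨ sym (ℕ.*-zeroʳ (suc k)) ⟩
  suc k ℕ.* 0                   ≡⟨ cong (suc k ℕ.*_) (sym (k>n⇒nCk≡0 (s≤s (ℕ.≰⇒> k≰n)))) ⟩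
  suc k ℕ.* (suc n C suc k)     ∎
  where open ≡-Reasoning

signedBinomial : ℕ → ℕ → ℤ
signedBinomial j i = -1ℤ ^ i * + (j C i)

signedBinomial-suc : ∀ j i →
  signedBinomial (suc j) (suc i) ≡ signedBinomial j (suc i) - signedBinomial j i
signedBinomial-suc j i = begin
  -1ℤ ^ suc i * + (suc j C suc i)
    ≡⟨ cong (λ c → -1ℤ ^ suc i * + c) (sym (nCk+nC[k+1]≡[n+1]C[k+1] j i)) ⟩
  -1ℤ ^ suc i * + (j C i ℕ.+ j C suc i)
    ≡⟨ cong (-1ℤ ^ suc i *_) (pos-+ (j C i) (j C suc i)) ⟩
  -1ℤ * -1ℤ ^ i * (+ (j C i) + + (j C suc i))
    ≡⟨ expand (-1ℤ ^ i) (+ (j C i)) (+ (j C suc i)) ⟩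
  -1ℤ * -1ℤ ^ i * + (j C suc i) - -1ℤ ^ i * + (j C i) ∎
  where
  open ≡-Reasoning
  expand : ∀ s a b → -1ℤ * s * (a + b) ≡ -1ℤ * s * b - s * a
  expand = solve-∀

signedBinomial-vanish : ∀ {j i} → j < i → signedBinomial j i ≡ 0ℤ
signedBinomial-vanish {j} {i} j<i =
  trans (cong (λ c → -1ℤ ^ i * + c) (k>n⇒nCk≡0 j<i)) (ℤ.*-zeroʳ (-1ℤ ^ i))

∑-signedBinomial-head : ∀ j (f : ℕ → ℤ) →
  ∑[ i < suc j ] (signedBinomial j i * f i) ≡ f 0 + ∑[ i < j ] (signedBinomial j (suc i) * f (suc i))
∑-signedBinomial-head j f =
  trans (∑-head j _) (cong (_+ ∑[ i < j ] (signedBinomial j (suc i) * f (suc i))) (ℤ.*-identityˡ (f 0)))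

signedBinomial-telescope : ∀ j (f : ℕ → ℤ) →
  ∑[ i < suc j ] (signedBinomial j i * (f i - f (suc i))) ≡
  ∑[ i < suc (suc j) ] (signedBinomial (suc j) i * f i)
signedBinomial-telescope j f = begin
  ∑[ i < suc j ] (signedBinomial j i * (f i - f (suc i)))
    ≡⟨ ∑-cong (suc j) (λ i _ → ℤ.*-distribˡ-+ (signedBinomial j i) (f i) (- f (suc i))) ⟩
  ∑[ i < suc j ] (signedBinomial j i * f i + signedBinomial j i * - f (suc i))
    ≡⟨ ∑-distrib-+ (suc j) _ _ ⟩
  ∑[ i < suc j ] (signedBinomial j i * f i) + ∑[ i < suc j ] (signedBinomial j i * - f (suc i))
    ≡⟨ cong₂ _+_ (trans (∑-signedBinomial-head j f) (cong (λ s → f 0 + s) (sym A-last)))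
                 (∑-cong (suc j) λ i _ → sym (ℤ.neg-distribʳ-* (signedBinomial j i) (f (suc i)))) ⟩
  f 0 + A + ∑[ i < suc j ] (- (signedBinomial j i * f (suc i)))
    ≡⟨ cong (λ s → f 0 + A + s) (sym (∑-neg (suc j) _)) ⟩
  f 0 + A - B
    ≡⟨ ℤ.+-assoc (f 0) A (- B) ⟩
  f 0 + (A - B)
    ≡⟨ cong (λ s → f 0 + s) (sym (∑-distrib-minus (suc j) _ _)) ⟩
  f 0 + ∑[ i < suc j ] (signedBinomial j (suc i) * f (suc i) - signedBinomial j i * f (suc i))
    ≡⟨ cong (λ s → f 0 + s) (∑-cong (suc j) λ i _ → trans
         (sym ([y-z]x≈yx-zx (f (suc i)) (signedBinomial j (suc i)) (signedBinomial j i)))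
         (cong (_* f (suc i)) (sym (signedBinomial-suc j i)))) ⟩
  f 0 + ∑[ i < suc j ] (signedBinomial (suc j) (suc i) * f (suc i))
    ≡⟨ sym (∑-signedBinomial-head (suc j) f) ⟩
  ∑[ i < suc (suc j) ] (signedBinomial (suc j) i * f i) ∎
  where
  open ≡-Reasoning
  A = ∑[ i < suc j ] (signedBinomial j (suc i) * f (suc i))
  A-last : A ≡ ∑[ i < j ] (signedBinomial j (suc i) * f (suc i))
  A-last = ∑-truncate _ (ℕ.n≤1+n j) λ i j≤i →
    trans (cong (_* f (suc i)) (signedBinomial-vanish (s≤s j≤i))) (ℤ.*-zeroˡ (f (suc i)))
  B = ∑[ i < suc j ] (signedBinomial j i * f (suc i))

alternating-binomial-sum : ∀ j → ∑[ i < suc j ] (-1ℤ ^ i * + (suc j C suc i)) ≡ 1ℤ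
alternating-binomial-sum j = sym (ℤ.i-j≡0⇒i≡j 1ℤ X (begin
  1ℤ - X
    ≡⟨ cong (λ s → 1ℤ + s) (∑-neg (suc j) _) ⟩
  1ℤ + ∑[ i < suc j ] (- (-1ℤ ^ i * + (suc j C suc i)))
    ≡⟨ cong₂ _+_ (sym (cong (λ u → + 1 * (1ℤ * u)) (ℤ.^-zeroˡ (suc j))))
                 (∑-cong (suc j) λ i _ → trans (flip-sign (-1ℤ ^ i) (+ (suc j C suc i)))
                   (cong (λ u → + (suc j C suc i) * (-1ℤ ^ suc i * u)) (sym (ℤ.^-zeroˡ (j ∸ i))))) ⟩
  term 0 + ∑ (suc j) (term ∘ suc)
    ≡⟨ sym (∑-head (suc j) term) ⟩
  ∑ (suc (suc j)) term
    ≡⟨ sym (binomial-theorem (suc j) -1ℤ 1ℤ) ⟩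
  (-1ℤ + 1ℤ) ^ suc j
    ≡⟨⟩
  0ℤ ∎))
  where
  open ≡-Reasoning
  X = ∑[ i < suc j ] (-1ℤ ^ i * + (suc j C suc i))
  term : ℕ → ℤ
  term i = + (suc j C i) * (-1ℤ ^ i * 1ℤ ^ (suc j ∸ i))
  flip-sign : ∀ s c → - (s * c) ≡ c * (-1ℤ * s * 1ℤ)
  flip-sign = solve-∀

-- Exponential generating functions with integer coefficients

infixl 7 _⊛_
_⊛_ : (ℕ → ℤ) → (ℕ → ℤ) → ℕ → ℤ
(u ⊛ v) n = ∑[ i < suc n ] (+ (n C i) * (u i * v (n ∸ i)))

exp : ℤ → ℕ → ℤ
exp a n = a ^ n

expSum : ℕ → (ℕ → ℤ) → (ℕ → ℤ) → ℕ → ℤ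
expSum m c z n = ∑[ j < m ] (c j * exp (z j) n)

⊛-congʳ : ∀ u {v w : ℕ → ℤ} → (∀ i → v i ≡ w i) → ∀ n → (u ⊛ v) n ≡ (u ⊛ w) n
⊛-congʳ u v≡w n = ∑-cong (suc n) λ i _ → cong (λ x → + (n C i) * (u i * x)) (v≡w (n ∸ i))

⊛-distribʳ-minus : ∀ u v w n → ((λ N → u N - v N) ⊛ w) n ≡ (u ⊛ w) n - (v ⊛ w) n
⊛-distribʳ-minus u v w n =
  trans (∑-cong (suc n) λ i _ → trans (cong (+ (n C i) *_) ([y-z]x≈yx-zx (w (n ∸ i)) (u i) (v i)))
                                      (x[y-z]≈xy-xz (+ (n C i)) _ _))
        (∑-distrib-minus (suc n) _ _)

⊛-∑ʳ : ∀ u m (c : ℕ → ℤ) (f : ℕ → ℕ → ℤ) n →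
  (u ⊛ (λ N → ∑[ j < m ] (c j * f j N))) n ≡ ∑[ j < m ] (c j * (u ⊛ f j) n)
⊛-∑ʳ u m c f n = begin
  ∑[ i < suc n ] (+ (n C i) * (u i * ∑[ j < m ] (c j * f j (n ∸ i))))
    ≡⟨ ∑-cong (suc n) (λ i _ → trans (cong (+ (n C i) *_) (*-distribˡ-∑ m (u i) _)) (*-distribˡ-∑ m (+ (n C i)) _)) ⟩
  ∑[ i < suc n ] ∑[ j < m ] (+ (n C i) * (u i * (c j * f j (n ∸ i))))
    ≡⟨ ∑-comm (suc n) m _ ⟩
  ∑[ j < m ] ∑[ i < suc n ] (+ (n C i) * (u i * (c j * f j (n ∸ i))))
    ≡⟨ ∑-cong m (λ j _ → trans (∑-cong (suc n) λ i _ → pull (+ (n C i)) (u i) (c j) (f j (n ∸ i)))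
                                (sym (*-distribˡ-∑ (suc n) (c j) _))) ⟩
  ∑[ j < m ] (c j * (u ⊛ f j) n) ∎
  where
  open ≡-Reasoning
  pull : ∀ b x c y → b * (x * (c * y)) ≡ c * (b * (x * y))
  pull = solve-∀

exp-⊛-exp : ∀ a b n → (exp a ⊛ exp b) n ≡ exp (a + b) n
exp-⊛-exp a b n = sym (binomial-theorem n a b)

exp-⊛-expSum : ∀ a m c z n → (exp a ⊛ expSum m c z) n ≡ expSum m c (λ j → a + z j) n
exp-⊛-expSum a m c z n =
  trans (⊛-∑ʳ (exp a) m c (exp ∘ z) n) (∑-cong m λ j _ → cong (c j *_) (exp-⊛-exp a (z j) n))

expDiff-⊛-expSum : ∀ a b m c z n →
  ((λ N → exp a N - exp b N) ⊛ expSum m c z) n ≡ ∑[ j < m ] (c j * (exp (a + z j) n - exp (b + z j) n))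
expDiff-⊛-expSum a b m c z n = begin
  ((λ N → exp a N - exp b N) ⊛ expSum m c z) n
    ≡⟨ ⊛-distribʳ-minus (exp a) (exp b) (expSum m c z) n ⟩
  (exp a ⊛ expSum m c z) n - (exp b ⊛ expSum m c z) n
    ≡⟨ cong₂ _-_ (exp-⊛-expSum a m c z n) (exp-⊛-expSum b m c z n) ⟩
  expSum m c (λ j → a + z j) n - expSum m c (λ j → b + z j) n
    ≡⟨ sym (∑-distrib-minus m _ _) ⟩
  ∑[ j < m ] (c j * exp (a + z j) n - c j * exp (b + z j) n)
    ≡⟨ ∑-cong m (λ j _ → sym (x[y-z]≈xy-xz (c j) _ _)) ⟩
  ∑[ j < m ] (c j * (exp (a + z j) n - exp (b + z j) n)) ∎
  where open ≡-Reasoning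

⊛-vanish : ∀ a b {u v : ℕ → ℤ} → (∀ i → i < a → u i ≡ 0ℤ) → (∀ k → k < b → v k ≡ 0ℤ) →
           ∀ n → n < a ℕ.+ b → (u ⊛ v) n ≡ 0ℤ
⊛-vanish a b {u} {v} u≡0 v≡0 n n<a+b = ∑-zero (suc n) term≡0
  where
  open ≡-Reasoning
  term≡0 : ∀ i → i < suc n → + (n C i) * (u i * v (n ∸ i)) ≡ 0ℤ
  term≡0 i i<1+n with i ℕ.<? a
  ... | yes i<a = begin
    + (n C i) * (u i * v (n ∸ i)) ≡⟨ cong (λ x → + (n C i) * (x * v (n ∸ i))) (u≡0 i i<a) ⟩
    + (n C i) * 0ℤ                ≡⟨ ℤ.*-zeroʳ (+ (n C i)) ⟩
    0ℤ                            ∎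
  ... | no  i≮a = begin
    + (n C i) * (u i * v (n ∸ i)) ≡⟨ cong (λ x → + (n C i) * (u i * x)) (v≡0 (n ∸ i) n∸i<b) ⟩
    + (n C i) * (u i * 0ℤ)        ≡⟨ cong (+ (n C i) *_) (ℤ.*-zeroʳ (u i)) ⟩
    + (n C i) * 0ℤ                ≡⟨ ℤ.*-zeroʳ (+ (n C i)) ⟩
    0ℤ                            ∎
    where
    n∸i<b : n ∸ i < b
    n∸i<b = ℕ.+-cancelˡ-< i (n ∸ i) b (subst (_< i ℕ.+ b) (sym (ℕ.m+[n∸m]≡n (ℕ.m<1+n⇒m≤n i<1+n)))
              (ℕ.<-≤-trans n<a+b (ℕ.+-monoˡ-≤ b (ℕ.≮⇒≥ i≮a))))

-- The integer formula for C_n^{(-m)}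

oneMinusExpNegℤ : ℕ → ℤ
oneMinusExpNegℤ n = exp 0ℤ n - exp -1ℤ n

expMinusOneℤ : ℕ → ℤ
expMinusOneℤ n = exp 1ℤ n - exp 0ℤ n

powℤ : ℕ → ℕ → ℤ
powℤ zero    = exp 0ℤ
powℤ (suc j) = oneMinusExpNegℤ ⊛ powℤ j

expNegPowℤ : ℕ → ℕ → ℤ
expNegPowℤ j = expSum (suc j) (signedBinomial j) (λ i → -1ℤ - + i)

powℤ-vanish : ∀ j n → n < j → powℤ j n ≡ 0ℤ
powℤ-vanish (suc j) = ⊛-vanish 1 j {oneMinusExpNegℤ} (λ { zero _ → refl ; (suc i) (s≤s ()) }) (powℤ-vanish j)

private
  -1-i≡-[1+i] : ∀ i → -1ℤ - + i ≡ - + suc i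
  -1-i≡-[1+i] zero    = refl
  -1-i≡-[1+i] (suc i) = refl

expSum-telescope : ∀ j n →
  ∑[ i < suc j ] (signedBinomial j i * (exp (- + i) n - exp (-1ℤ - + i) n)) ≡
  expSum (suc (suc j)) (signedBinomial (suc j)) (λ i → - + i) n
expSum-telescope j n = trans
  (∑-cong (suc j) λ i _ → cong (λ z → signedBinomial j i * (exp (- + i) n - exp z n)) (-1-i≡-[1+i] i))
  (signedBinomial-telescope j (λ i → exp (- + i) n))

powℤ≡expSum : ∀ j n → powℤ j n ≡ expSum (suc j) (signedBinomial j) (λ i → - + i) n
powℤ≡expSum zero    n = sym (trans (ℤ.+-identityˡ _) (ℤ.*-identityˡ _))
powℤ≡expSum (suc j) n = begin
  (oneMinusExpNegℤ ⊛ powℤ j) n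
    ≡⟨ ⊛-congʳ oneMinusExpNegℤ (powℤ≡expSum j) n ⟩
  (oneMinusExpNegℤ ⊛ expSum (suc j) (signedBinomial j) (λ i → - + i)) n
    ≡⟨ expDiff-⊛-expSum 0ℤ -1ℤ (suc j) (signedBinomial j) (λ i → - + i) n ⟩
  ∑[ i < suc j ] (signedBinomial j i * (exp (0ℤ + - + i) n - exp (-1ℤ - + i) n))
    ≡⟨ ∑-cong (suc j) (λ i _ → cong (λ z → signedBinomial j i * (exp z n - exp (-1ℤ - + i) n))
                                    (ℤ.+-identityˡ (- + i))) ⟩
  ∑[ i < suc j ] (signedBinomial j i * (exp (- + i) n - exp (-1ℤ - + i) n))
    ≡⟨ expSum-telescope j n ⟩
  expSum (suc (suc j)) (signedBinomial (suc j)) (λ i → - + i) n ∎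
  where open ≡-Reasoning

expNegPowℤ≡exp⊛powℤ : ∀ j n → expNegPowℤ j n ≡ (exp -1ℤ ⊛ powℤ j) n
expNegPowℤ≡exp⊛powℤ j n = sym (trans (⊛-congʳ (exp -1ℤ) (powℤ≡expSum j) n)
                                     (exp-⊛-expSum -1ℤ (suc j) (signedBinomial j) (λ i → - + i) n))

expNegPowℤ-vanish : ∀ j n → n < j → expNegPowℤ j n ≡ 0ℤ
expNegPowℤ-vanish j n n<j =
  trans (expNegPowℤ≡exp⊛powℤ j n) (⊛-vanish 0 j {exp -1ℤ} (λ _ ()) (powℤ-vanish j) n n<j)

expMinusOne⊛expNegPowℤ : ∀ j n → (expMinusOneℤ ⊛ expNegPowℤ j) n ≡ powℤ (suc j) n
expMinusOne⊛expNegPowℤ j n = begin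
  (expMinusOneℤ ⊛ expNegPowℤ j) n
    ≡⟨ expDiff-⊛-expSum 1ℤ 0ℤ (suc j) (signedBinomial j) (λ i → -1ℤ - + i) n ⟩
  ∑[ i < suc j ] (signedBinomial j i * (exp (1ℤ + (-1ℤ - + i)) n - exp (0ℤ + (-1ℤ - + i)) n))
    ≡⟨ ∑-cong (suc j) (λ i _ → cong₂ (λ y z → signedBinomial j i * (exp y n - exp z n))
                                     (cancel (+ i)) (ℤ.+-identityˡ (-1ℤ - + i))) ⟩
  ∑[ i < suc j ] (signedBinomial j i * (exp (- + i) n - exp (-1ℤ - + i) n))
    ≡⟨ expSum-telescope j n ⟩
  expSum (suc (suc j)) (signedBinomial (suc j)) (λ i → - + i) n
    ≡⟨ sym (powℤ≡expSum (suc j) n) ⟩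
  powℤ (suc j) n ∎
  where
  open ≡-Reasoning
  cancel : ∀ x → 1ℤ + (-1ℤ - x) ≡ - x
  cancel = solve-∀

liNegCoeff : ℕ → ℕ → ℤ
liNegCoeff m zero    = 0ℤ
liNegCoeff m (suc j) = + (suc j ℕ.^ m)

LiNegCompℤ : ℕ → ℕ → ℤ
LiNegCompℤ m n = ∑[ j < suc n ] (liNegCoeff m j * powℤ j n)

polyBernSum : ℕ → ℕ → ℕ → ℤ
polyBernSum m B n = ∑[ j < suc B ] (liNegCoeff m (suc j) * expNegPowℤ j n)

polyBernℤ : ℕ → ℕ → ℤ
polyBernℤ m n = polyBernSum m n n

polyBernSum-stable : ∀ m {B n} → n ≤ B → polyBernSum m B n ≡ polyBernℤ m n
polyBernSum-stable m {B} {n} n≤B = ∑-truncate _ (s≤s n≤B) λ j n<j →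
  trans (cong (liNegCoeff m (suc j) *_) (expNegPowℤ-vanish j n n<j)) (ℤ.*-zeroʳ (liNegCoeff m (suc j)))

expMinusOne⊛polyBernSum : ∀ m B n → n ≤ suc B → (expMinusOneℤ ⊛ polyBernSum m B) n ≡ LiNegCompℤ m n
expMinusOne⊛polyBernSum m B n n≤1+B = begin
  (expMinusOneℤ ⊛ polyBernSum m B) n
    ≡⟨ ⊛-∑ʳ expMinusOneℤ (suc B) (liNegCoeff m ∘ suc) expNegPowℤ n ⟩
  ∑[ j < suc B ] (liNegCoeff m (suc j) * (expMinusOneℤ ⊛ expNegPowℤ j) n)
    ≡⟨ ∑-cong (suc B) (λ j _ → cong (liNegCoeff m (suc j) *_) (expMinusOne⊛expNegPowℤ j n)) ⟩
  ∑[ j < suc B ] (liNegCoeff m (suc j) * powℤ (suc j) n)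
    ≡⟨ ∑-truncate _ n≤1+B (λ j n≤j →
         trans (cong (liNegCoeff m (suc j) *_) (powℤ-vanish (suc j) n (s≤s n≤j))) (ℤ.*-zeroʳ (liNegCoeff m (suc j)))) ⟩
  ∑[ j < n ] (liNegCoeff m (suc j) * powℤ (suc j) n)
    ≡⟨ sym (trans (∑-head n _) (ℤ.+-identityˡ _)) ⟩
  LiNegCompℤ m n ∎
  where open ≡-Reasoning

-- Transfer to the rational power series of Defs

toℚ : ℤ → ℚ
toℚ a = a / 1

private
  toℚᵘ-/ : ∀ a n .{{_ : ℕ.NonZero n}} → ℚ.toℚᵘ (a / n) ℚᵘ.≃ ℚᵘ.mkℚᵘ a (ℕ.pred n)
  toℚᵘ-/ a (suc n) = ℚ.toℚᵘ-fromℚᵘ (ℚᵘ.mkℚᵘ a n)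

  ℚ-ring : ACR.AlmostCommutativeRing _ _
  ℚ-ring = ACR.fromCommutativeRing ℚ.+-*-commutativeRing (λ _ → nothing)

toℚ-homo-+ : ∀ a b → toℚ (a + b) ≡ toℚ a ℚ.+ toℚ b
toℚ-homo-+ a b = ℚ.toℚᵘ-injective (ℚᵘ.≃-trans (toℚᵘ-/ (a + b) 1) (ℚᵘ.≃-sym
  (ℚᵘ.≃-trans (ℚ.toℚᵘ-homo-+ (toℚ a) (toℚ b))
    (ℚᵘ.≃-trans (ℚᵘ.+-cong (toℚᵘ-/ a 1) (toℚᵘ-/ b 1)) (ℚᵘ.*≡* (eq a b))))))
  where
  eq : ∀ a b → (a * + 1 + b * + 1) * + 1 ≡ (a + b) * + 1
  eq = solve-∀

toℚ-homo-* : ∀ a b → toℚ (a * b) ≡ toℚ a ℚ.* toℚ b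
toℚ-homo-* a b = ℚ.toℚᵘ-injective (ℚᵘ.≃-trans (toℚᵘ-/ (a * b) 1) (ℚᵘ.≃-sym
  (ℚᵘ.≃-trans (ℚ.toℚᵘ-homo-* (toℚ a) (toℚ b))
    (ℚᵘ.*-cong (toℚᵘ-/ a 1) (toℚᵘ-/ b 1)))))

toℚ-homo‿- : ∀ a → toℚ (- a) ≡ ℚ.- toℚ a
toℚ-homo‿- a = ℚ.toℚᵘ-injective (ℚᵘ.≃-trans (toℚᵘ-/ (- a) 1) (ℚᵘ.≃-sym
  (ℚᵘ.≃-trans (ℚ.toℚᵘ-homo‿- (toℚ a)) (ℚᵘ.-‿cong (toℚᵘ-/ a 1)))))

/≡toℚ*1/ : ∀ a n .{{_ : ℕ.NonZero n}} → a / n ≡ toℚ a ℚ.* (+ 1 / n)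
/≡toℚ*1/ a (suc n) = ℚ.toℚᵘ-injective (ℚᵘ.≃-trans (toℚᵘ-/ a (suc n)) (ℚᵘ.≃-sym
  (ℚᵘ.≃-trans (ℚ.toℚᵘ-homo-* (toℚ a) (+ 1 / suc n))
    (ℚᵘ.≃-trans (ℚᵘ.*-cong (toℚᵘ-/ a 1) (toℚᵘ-/ (+ 1) (suc n))) (ℚᵘ.*≡* (eq a (+ suc n)))))))
  where
  eq : ∀ a d → (a * + 1) * d ≡ a * ((+ 1) * d)
  eq = solve-∀

toℚ*1/≡1 : ∀ n .{{_ : ℕ.NonZero n}} → toℚ (+ n) ℚ.* (+ 1 / n) ≡ 1ℚ
toℚ*1/≡1 (suc n) = ℚ.toℚᵘ-injective (ℚᵘ.≃-trans (ℚ.toℚᵘ-homo-* (toℚ (+ suc n)) (+ 1 / suc n))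
  (ℚᵘ.≃-trans (ℚᵘ.*-cong (toℚᵘ-/ (+ suc n) 1) (toℚᵘ-/ (+ 1) (suc n))) (ℚᵘ.*≡* (eq (+ suc n)))))
  where
  eq : ∀ d → (d * + 1) * + 1 ≡ + 1 * (+ 1 * d)
  eq = solve-∀

sumTo-cong : ∀ n {f g : ℕ → ℚ} → (∀ i → i ≤ n → f i ≡ g i) → sumTo n f ≡ sumTo n g
sumTo-cong zero    f≡g = f≡g 0 z≤n
sumTo-cong (suc n) f≡g =
  cong₂ ℚ._+_ (sumTo-cong n (λ i i≤n → f≡g i (ℕ.m≤n⇒m≤1+n i≤n))) (f≡g (suc n) ℕ.≤-refl)

sumTo-distribʳ : ∀ n (f : ℕ → ℚ) c → sumTo n f ℚ.* c ≡ sumTo n (λ i → f i ℚ.* c)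
sumTo-distribʳ zero    f c = refl
sumTo-distribʳ (suc n) f c =
  trans (ℚ.*-distribʳ-+ c (sumTo n f) (f (suc n))) (cong (ℚ._+ f (suc n) ℚ.* c) (sumTo-distribʳ n f c))

sumTo-head : ∀ n (f : ℕ → ℚ) → sumTo (suc n) f ≡ f 0 ℚ.+ sumTo n (f ∘ suc)
sumTo-head zero    f = refl
sumTo-head (suc n) f = trans (cong (ℚ._+ f (suc (suc n))) (sumTo-head n f)) (ℚ.+-assoc (f 0) _ _)

toℚ-∑ : ∀ n (f : ℕ → ℤ) → toℚ (∑ (suc n) f) ≡ sumTo n (toℚ ∘ f)
toℚ-∑ zero    f = cong toℚ (ℤ.+-identityˡ (f 0))
toℚ-∑ (suc n) f = trans (toℚ-homo-+ (∑ (suc n) f) (f (suc n))) (cong (ℚ._+ toℚ (f (suc n))) (toℚ-∑ n f))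

invFact : ℕ → ℚ
invFact n = (+ 1 / (n !)) {{n !≢0}}

toℚ[n!]*invFact : ∀ n → toℚ (+ (n !)) ℚ.* invFact n ≡ 1ℚ
toℚ[n!]*invFact n = toℚ*1/≡1 (n !) {{n !≢0}}

invFact-split : ∀ {n i} → i ≤ n → invFact i ℚ.* invFact (n ∸ i) ≡ toℚ (+ (n C i)) ℚ.* invFact n
invFact-split {n} {i} i≤n = begin
  x ℚ.* y
    ≡⟨ sym (ℚ.*-identityʳ (x ℚ.* y)) ⟩
  x ℚ.* y ℚ.* 1ℚ
    ≡⟨ cong (x ℚ.* y ℚ.*_) (sym (toℚ[n!]*invFact n)) ⟩
  x ℚ.* y ℚ.* (toℚ (+ (n !)) ℚ.* invFact n)
    ≡⟨ cong (λ k → x ℚ.* y ℚ.* (toℚ (+ k) ℚ.* invFact n)) (sym (nCk*k![n∸k]!≡n! i≤n)) ⟩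
  x ℚ.* y ℚ.* (toℚ (+ ((n C i) ℕ.* (i ! ℕ.* (n ∸ i) !))) ℚ.* invFact n)
    ≡⟨ cong (λ q → x ℚ.* y ℚ.* (q ℚ.* invFact n)) factorials ⟩
  x ℚ.* y ℚ.* (c ℚ.* (a ℚ.* b) ℚ.* invFact n)
    ≡⟨ rearrange x y c a b (invFact n) ⟩
  c ℚ.* (a ℚ.* x) ℚ.* (b ℚ.* y) ℚ.* invFact n
    ≡⟨ cong₂ (λ u v → c ℚ.* u ℚ.* v ℚ.* invFact n) (toℚ[n!]*invFact i) (toℚ[n!]*invFact (n ∸ i)) ⟩
  c ℚ.* 1ℚ ℚ.* 1ℚ ℚ.* invFact n
    ≡⟨ cong (ℚ._* invFact n) (trans (ℚ.*-identityʳ (c ℚ.* 1ℚ)) (ℚ.*-identityʳ c)) ⟩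
  c ℚ.* invFact n ∎
  where
  open ≡-Reasoning
  x = invFact i
  y = invFact (n ∸ i)
  a = toℚ (+ (i !))
  b = toℚ (+ ((n ∸ i) !))
  c = toℚ (+ (n C i))
  factorials : toℚ (+ ((n C i) ℕ.* (i ! ℕ.* (n ∸ i) !))) ≡ c ℚ.* (a ℚ.* b)
  factorials = begin
    toℚ (+ ((n C i) ℕ.* (i ! ℕ.* (n ∸ i) !)))
      ≡⟨ cong toℚ (trans (pos-* (n C i) _) (cong (+ (n C i) *_) (pos-* (i !) ((n ∸ i) !)))) ⟩
    toℚ (+ (n C i) * (+ (i !) * + ((n ∸ i) !)))
      ≡⟨ trans (toℚ-homo-* (+ (n C i)) _) (cong (c ℚ.*_) (toℚ-homo-* (+ (i !)) _)) ⟩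
    c ℚ.* (a ℚ.* b) ∎
  rearrange : ∀ x y c a b f → x ℚ.* y ℚ.* (c ℚ.* (a ℚ.* b) ℚ.* f) ≡ c ℚ.* (a ℚ.* x) ℚ.* (b ℚ.* y) ℚ.* f
  rearrange = ℚ-Solver.solve-∀ ℚ-ring

egf : (ℕ → ℤ) → Series
egf u n = toℚ (u n) ℚ.* invFact n

egf-⊛ : ∀ u v n → (egf u ⋆ egf v) n ≡ egf (u ⊛ v) n
egf-⊛ u v n = begin
  sumTo n (λ i → egf u i ℚ.* egf v (n ∸ i))
    ≡⟨ sumTo-cong n (λ i i≤n → term i i≤n) ⟩
  sumTo n (λ i → toℚ (+ (n C i) * (u i * v (n ∸ i))) ℚ.* invFact n)
    ≡⟨ sym (sumTo-distribʳ n _ (invFact n)) ⟩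
  sumTo n (λ i → toℚ (+ (n C i) * (u i * v (n ∸ i)))) ℚ.* invFact n
    ≡⟨ cong (ℚ._* invFact n) (sym (toℚ-∑ n _)) ⟩
  egf (u ⊛ v) n ∎
  where
  open ≡-Reasoning
  term : ∀ i → i ≤ n → egf u i ℚ.* egf v (n ∸ i) ≡ toℚ (+ (n C i) * (u i * v (n ∸ i))) ℚ.* invFact n
  term i i≤n = begin
    toℚ (u i) ℚ.* invFact i ℚ.* (toℚ (v (n ∸ i)) ℚ.* invFact (n ∸ i))
      ≡⟨ interchangeℚ (toℚ (u i)) (invFact i) (toℚ (v (n ∸ i))) (invFact (n ∸ i)) ⟩
    toℚ (u i) ℚ.* toℚ (v (n ∸ i)) ℚ.* (invFact i ℚ.* invFact (n ∸ i))
      ≡⟨ cong₂ ℚ._*_ (sym (toℚ-homo-* (u i) (v (n ∸ i)))) (invFact-split i≤n) ⟩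
    toℚ (u i * v (n ∸ i)) ℚ.* (toℚ (+ (n C i)) ℚ.* invFact n)
      ≡⟨ sym (ℚ.*-assoc (toℚ (u i * v (n ∸ i))) (toℚ (+ (n C i))) (invFact n)) ⟩
    toℚ (u i * v (n ∸ i)) ℚ.* toℚ (+ (n C i)) ℚ.* invFact n
      ≡⟨ cong (ℚ._* invFact n) (trans (ℚ.*-comm (toℚ (u i * v (n ∸ i))) (toℚ (+ (n C i))))
                                      (sym (toℚ-homo-* (+ (n C i)) (u i * v (n ∸ i))))) ⟩
    toℚ (+ (n C i) * (u i * v (n ∸ i))) ℚ.* invFact n ∎
    where
    interchangeℚ : ∀ a x b y → a ℚ.* x ℚ.* (b ℚ.* y) ≡ a ℚ.* b ℚ.* (x ℚ.* y)
    interchangeℚ = ℚ-Solver.solve-∀ ℚ-ring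

/n!≡toℚ*invFact : ∀ a n → (a / (n !)) {{n !≢0}} ≡ toℚ a ℚ.* invFact n
/n!≡toℚ*invFact a n = /≡toℚ*1/ a (n !) {{n !≢0}}

-- Defs.expNeg takes its sign from a local function that cannot be named here.  Abstracting the
-- arguments of its unfolding turns that term into a pattern, so unification names it for us:
-- expNegTerm y m d is (that sign at m) / d.
mutual
  expNegTerm : ℕ → ℕ → (d : ℕ) → .{{ℕ.NonZero d}} → ℚ
  expNegTerm = _

  expNeg≡expNegTerm : ∀ m → expNeg (suc (suc m)) ≡ expNegTerm (suc (suc m)) m (suc (suc m) !) {{suc (suc m) !≢0}}
  expNeg≡expNegTerm m with suc (suc m) ! | suc (suc m) !≢0 | suc (suc m)
  ... | d | d≢0 | y = refl

expNegTerm≡-1^m/d : ∀ y m d .{{_ : ℕ.NonZero d}} → expNegTerm y m d ≡ (-1ℤ ^ m) / d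
expNegTerm≡-1^m/d y zero          d = refl
expNegTerm≡-1^m/d y (suc zero)    d = refl
expNegTerm≡-1^m/d y (suc (suc m)) d =
  trans (expNegTerm≡-1^m/d y m d) (cong (_/ d) (sym (-1*[-1*x]≡x (-1ℤ ^ m))))
  where
  -1*[-1*x]≡x : ∀ x → -1ℤ * (-1ℤ * x) ≡ x
  -1*[-1*x]≡x = solve-∀

expNeg≡egf : ∀ n → expNeg n ≡ egf (exp -1ℤ) n
expNeg≡egf zero          = refl
expNeg≡egf (suc zero)    = refl
expNeg≡egf (suc (suc m)) =
  trans (expNeg≡expNegTerm m)
        (trans (expNegTerm≡-1^m/d (suc (suc m)) (suc (suc m)) (suc (suc m) !) {{suc (suc m) !≢0}})
               (/n!≡toℚ*invFact (-1ℤ ^ suc (suc m)) (suc (suc m))))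

oneMinusExpNeg≡egf : ∀ n → oneMinusExpNeg n ≡ egf oneMinusExpNegℤ n
oneMinusExpNeg≡egf zero    = refl
oneMinusExpNeg≡egf (suc n) = sym (begin
  toℚ (0ℤ - exp -1ℤ (suc n)) ℚ.* invFact (suc n)
    ≡⟨ cong (λ a → toℚ a ℚ.* invFact (suc n)) (ℤ.+-identityˡ (- exp -1ℤ (suc n))) ⟩
  toℚ (- exp -1ℤ (suc n)) ℚ.* invFact (suc n)
    ≡⟨ cong (ℚ._* invFact (suc n)) (toℚ-homo‿- (exp -1ℤ (suc n))) ⟩
  ℚ.- toℚ (exp -1ℤ (suc n)) ℚ.* invFact (suc n)
    ≡⟨ sym (ℚ.neg-distribˡ-* (toℚ (exp -1ℤ (suc n))) (invFact (suc n))) ⟩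
  ℚ.- egf (exp -1ℤ) (suc n)
    ≡⟨ cong ℚ.-_ (sym (expNeg≡egf (suc n))) ⟩
  ℚ.- expNeg (suc n) ∎)
  where open ≡-Reasoning

pow≡egf : ∀ j n → pow oneMinusExpNeg j n ≡ egf (powℤ j) n
pow≡egf zero    zero    = refl
pow≡egf zero    (suc n) = sym (ℚ.*-zeroˡ (invFact (suc n)))
pow≡egf (suc j) n =
  trans (sumTo-cong n (λ i _ → cong₂ ℚ._*_ (oneMinusExpNeg≡egf i) (pow≡egf j (n ∸ i))))
        (egf-⊛ oneMinusExpNegℤ (powℤ j) n)

LiNegComp≡egf : ∀ m n → LiNegComp m n ≡ egf (LiNegCompℤ m) n
LiNegComp≡egf m n = begin
  sumTo n (λ j → LiNeg m j ℚ.* pow oneMinusExpNeg j n)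
    ≡⟨ sumTo-cong n (λ j _ → cong₂ ℚ._*_ (LiNeg≡toℚ j) (pow≡egf j n)) ⟩
  sumTo n (λ j → toℚ (liNegCoeff m j) ℚ.* (toℚ (powℤ j n) ℚ.* invFact n))
    ≡⟨ sumTo-cong n (λ j _ → trans (sym (ℚ.*-assoc (toℚ (liNegCoeff m j)) (toℚ (powℤ j n)) (invFact n)))
                                   (cong (ℚ._* invFact n) (sym (toℚ-homo-* (liNegCoeff m j) (powℤ j n))))) ⟩
  sumTo n (λ j → toℚ (liNegCoeff m j * powℤ j n) ℚ.* invFact n)
    ≡⟨ sym (sumTo-distribʳ n _ (invFact n)) ⟩
  sumTo n (λ j → toℚ (liNegCoeff m j * powℤ j n)) ℚ.* invFact n
    ≡⟨ cong (ℚ._* invFact n) (sym (toℚ-∑ n _)) ⟩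
  egf (LiNegCompℤ m) n ∎
  where
  open ≡-Reasoning
  LiNeg≡toℚ : ∀ j → LiNeg m j ≡ toℚ (liNegCoeff m j)
  LiNeg≡toℚ zero    = refl
  LiNeg≡toℚ (suc j) = refl

expm1OverT≡egf : ∀ n → expm1OverT n ≡ egf expMinusOneℤ (suc n)
expm1OverT≡egf n = begin
  (+ 1 / (suc n !)) {{suc n !≢0}}
    ≡⟨ /n!≡toℚ*invFact (+ 1) (suc n) ⟩
  toℚ 1ℤ ℚ.* invFact (suc n)
    ≡⟨ cong (λ a → toℚ a ℚ.* invFact (suc n)) (sym (trans (ℤ.+-identityʳ (1ℤ * 1ℤ ^ n)) (ℤ.^-zeroˡ (suc n)))) ⟩
  egf expMinusOneℤ (suc n) ∎
  where open ≡-Reasoning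

LiNegComp≡egf⋆egf : ∀ m B n → n ≤ suc B →
  LiNegComp m n ≡ (egf expMinusOneℤ ⋆ egf (polyBernSum m B)) n
LiNegComp≡egf⋆egf m B n n≤1+B = begin
  LiNegComp m n
    ≡⟨ LiNegComp≡egf m n ⟩
  egf (LiNegCompℤ m) n
    ≡⟨ cong (λ a → toℚ a ℚ.* invFact n) (sym (expMinusOne⊛polyBernSum m B n n≤1+B)) ⟩
  egf (expMinusOneℤ ⊛ polyBernSum m B) n
    ≡⟨ sym (egf-⊛ expMinusOneℤ (polyBernSum m B) n) ⟩
  (egf expMinusOneℤ ⋆ egf (polyBernSum m B)) n ∎
  where open ≡-Reasoning

egf-polyBernSum-stable : ∀ m {B i} → i ≤ B → egf (polyBernSum m B) i ≡ egf (polyBernℤ m) i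
egf-polyBernSum-stable m {i = i} i≤B = cong (λ a → toℚ a ℚ.* invFact i) (polyBernSum-stable m i≤B)

quotPrefix≡egf : ∀ m n i → i ≤ n → quotPrefix m n i ≡ egf (polyBernℤ m) i
quotPrefix≡egf m zero zero z≤n = begin
  LiNegComp m 1
    ≡⟨ LiNegComp≡egf⋆egf m 0 1 ℕ.≤-refl ⟩
  0ℚ ℚ.* egf (polyBernSum m 0) 1 ℚ.+ 1ℚ ℚ.* egf (polyBernℤ m) 0
    ≡⟨ simplify (egf (polyBernSum m 0) 1) (egf (polyBernℤ m) 0) ⟩
  egf (polyBernℤ m) 0 ∎
  where
  open ≡-Reasoning
  simplify : ∀ x y → 0ℚ ℚ.* x ℚ.+ 1ℚ ℚ.* y ≡ y
  simplify x y = trans (cong₂ ℚ._+_ (ℚ.*-zeroˡ x) (ℚ.*-identityˡ y)) (ℚ.+-identityˡ y)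
quotPrefix≡egf m (suc n) i i≤1+n with i ℕ.≤ᵇ n in eq
... | true  = quotPrefix≡egf m n i (ℕ.≤ᵇ⇒≤ i n (subst T (sym eq) tt))
... | false with ℕ.m≤n⇒m<n∨m≡n i≤1+n
...   | inj₁ (s≤s i≤n) = ⊥-elim (subst T eq (ℕ.≤⇒≤ᵇ i≤n))
...   | inj₂ refl = begin
  LiNegComp m (suc (suc n)) ℚ.- S
    ≡⟨ cong (ℚ._- S) (LiNegComp≡egf⋆egf m (suc n) (suc (suc n)) ℕ.≤-refl) ⟩
  (E ⋆ H) (suc (suc n)) ℚ.- S
    ≡⟨ cong (ℚ._- S) (trans (sumTo-head (suc n) _) (cong (E 0 ℚ.* H (suc (suc n)) ℚ.+_) (sumTo-head n _))) ⟩
  0ℚ ℚ.* H (suc (suc n)) ℚ.+ (1ℚ ℚ.* H (suc n) ℚ.+ sumTo n (λ k → E (suc (suc k)) ℚ.* H (n ∸ k))) ℚ.- S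
    ≡⟨ cong (λ t → 0ℚ ℚ.* H (suc (suc n)) ℚ.+ (1ℚ ℚ.* H (suc n) ℚ.+ t) ℚ.- S) tail≡S ⟩
  0ℚ ℚ.* H (suc (suc n)) ℚ.+ (1ℚ ℚ.* H (suc n) ℚ.+ S) ℚ.- S
    ≡⟨ simplify (H (suc (suc n))) (H (suc n)) S ⟩
  H (suc n)
    ≡⟨ egf-polyBernSum-stable m {suc n} ℕ.≤-refl ⟩
  egf (polyBernℤ m) (suc n) ∎
  where
  open ≡-Reasoning
  E = egf expMinusOneℤ
  H = egf (polyBernSum m (suc n))
  S = sumTo n (λ j → expm1OverT (suc j) ℚ.* quotPrefix m n (n ∸ j))
  tail≡S : sumTo n (λ k → E (suc (suc k)) ℚ.* H (n ∸ k)) ≡ S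
  tail≡S = sumTo-cong n λ k _ → cong₂ ℚ._*_ (sym (expm1OverT≡egf (suc k)))
    (trans (egf-polyBernSum-stable m (ℕ.≤-trans (ℕ.m∸n≤m n k) (ℕ.n≤1+n n)))
           (sym (quotPrefix≡egf m n (n ∸ k) (ℕ.m∸n≤m n k))))
  simplify : ∀ x y s → 0ℚ ℚ.* x ℚ.+ (1ℚ ℚ.* y ℚ.+ s) ℚ.- s ≡ y
  simplify x y s = begin
    0ℚ ℚ.* x ℚ.+ (1ℚ ℚ.* y ℚ.+ s) ℚ.- s
      ≡⟨ cong₂ (λ a b → a ℚ.+ (b ℚ.+ s) ℚ.- s) (ℚ.*-zeroˡ x) (ℚ.*-identityˡ y) ⟩
    0ℚ ℚ.+ (y ℚ.+ s) ℚ.- s  ≡⟨ cong (ℚ._- s) (ℚ.+-identityˡ (y ℚ.+ s)) ⟩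
    y ℚ.+ s ℚ.- s           ≡⟨ ℚ.+-assoc y s (ℚ.- s) ⟩
    y ℚ.+ (s ℚ.- s)         ≡⟨ cong (y ℚ.+_) (ℚ.+-inverseʳ s) ⟩
    y ℚ.+ 0ℚ                ≡⟨ ℚ.+-identityʳ y ⟩
    y                       ∎

polyBernC⁻≡polyBernℤ : ∀ m n → polyBernC⁻ m n ≡ toℚ (polyBernℤ m n)
polyBernC⁻≡polyBernℤ m n = begin
  toℚ (+ (n !)) ℚ.* quotPrefix m n n
    ≡⟨ cong (toℚ (+ (n !)) ℚ.*_) (quotPrefix≡egf m n n ℕ.≤-refl) ⟩
  toℚ (+ (n !)) ℚ.* (toℚ (polyBernℤ m n) ℚ.* invFact n)
    ≡⟨ swap (toℚ (+ (n !))) (toℚ (polyBernℤ m n)) (invFact n) ⟩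
  toℚ (polyBernℤ m n) ℚ.* (toℚ (+ (n !)) ℚ.* invFact n)
    ≡⟨ cong (toℚ (polyBernℤ m n) ℚ.*_) (toℚ[n!]*invFact n) ⟩
  toℚ (polyBernℤ m n) ℚ.* 1ℚ
    ≡⟨ ℚ.*-identityʳ (toℚ (polyBernℤ m n)) ⟩
  toℚ (polyBernℤ m n) ∎
  where
  open ≡-Reasoning
  swap : ∀ a b c → a ℚ.* (b ℚ.* c) ≡ b ℚ.* (a ℚ.* c)
  swap = ℚ-Solver.solve-∀ ℚ-ring

infix 4 _≡_mod_
-- A record rather than a synonym for p ∣ a - b, so that a and b can be inferred.
record _≡_mod_ (a b : ℤ) (p : ℕ) : Set where
  constructor divides-diff
  field modulus∣diff : + p Signed.∣ a - b

module _ {p : ℕ} where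

  ≡⇒≡-mod : ∀ {a b} → a ≡ b → a ≡ b mod p
  ≡⇒≡-mod {a} refl = divides-diff (Signed.divides 0ℤ (ℤ.+-inverseʳ a))

  ≡-mod-sym : ∀ {a b} → a ≡ b mod p → b ≡ a mod p
  ≡-mod-sym {a} {b} (divides-diff p∣a-b) =
    divides-diff (subst (+ p Signed.∣_) (⁻¹-anti-homo‿- a b) (Signed.∣m⇒∣-m p∣a-b))

  ≡-mod-trans : ∀ {a b c} → a ≡ b mod p → b ≡ c mod p → a ≡ c mod p
  ≡-mod-trans {a} {b} {c} (divides-diff p∣a-b) (divides-diff p∣b-c) =
    divides-diff (subst (+ p Signed.∣_) (ℤ.+-minus-telescope a b c) (Signed.∣m∣n⇒∣m+n p∣a-b p∣b-c))

  +-cong-mod : ∀ {a b c d} → a ≡ b mod p → c ≡ d mod p → a + c ≡ b + d mod p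
  +-cong-mod {a} {b} {c} {d} (divides-diff p∣a-b) (divides-diff p∣c-d) =
    divides-diff (subst (+ p Signed.∣_) (regroup a b c d) (Signed.∣m∣n⇒∣m+n p∣a-b p∣c-d))
    where
    regroup : ∀ a b c d → (a - b) + (c - d) ≡ (a + c) - (b + d)
    regroup = solve-∀

  +-congˡ-mod : ∀ c {a b} → a ≡ b mod p → c + a ≡ c + b mod p
  +-congˡ-mod c = +-cong-mod (≡⇒≡-mod {a = c} refl)

  +-congʳ-mod : ∀ c {a b} → a ≡ b mod p → a + c ≡ b + c mod p
  +-congʳ-mod c a≡b = +-cong-mod a≡b (≡⇒≡-mod {a = c} refl)

  *-cong-mod : ∀ {a b c d} → a ≡ b mod p → c ≡ d mod p → a * c ≡ b * d mod p
  *-cong-mod {a} {b} {c} {d} (divides-diff p∣a-b) (divides-diff p∣c-d) =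
    divides-diff (subst (+ p Signed.∣_) (regroup a b c d)
      (Signed.∣m∣n⇒∣m+n (Signed.∣n⇒∣m*n a p∣c-d) (Signed.∣m⇒∣m*n d p∣a-b)))
    where
    regroup : ∀ a b c d → a * (c - d) + (a - b) * d ≡ a * c - b * d
    regroup = solve-∀

  *-congˡ-mod : ∀ c {a b} → a ≡ b mod p → c * a ≡ c * b mod p
  *-congˡ-mod c = *-cong-mod (≡⇒≡-mod {a = c} refl)

  *-congʳ-mod : ∀ c {a b} → a ≡ b mod p → a * c ≡ b * c mod p
  *-congʳ-mod c a≡b = *-cong-mod a≡b (≡⇒≡-mod {a = c} refl)

  ^-cong-mod : ∀ {a b} → a ≡ b mod p → ∀ k → a ^ k ≡ b ^ k mod p
  ^-cong-mod a≡b zero    = ≡⇒≡-mod refl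
  ^-cong-mod a≡b (suc k) = *-cong-mod a≡b (^-cong-mod a≡b k)

  ∑-cong-mod : ∀ n {f g : ℕ → ℤ} → (∀ i → i < n → f i ≡ g i mod p) → ∑ n f ≡ ∑ n g mod p
  ∑-cong-mod zero    f≡g = ≡⇒≡-mod refl
  ∑-cong-mod (suc n) f≡g =
    +-cong-mod (∑-cong-mod n (λ i i<n → f≡g i (ℕ.m<n⇒m<1+n i<n))) (f≡g n ℕ.≤-refl)

  ∣⇒≡0-mod : ∀ {m} → p ∣ m → + m ≡ 0ℤ mod p
  ∣⇒≡0-mod {m} (divides q m≡q*p) = divides-diff
    (Signed.divides (+ q) (trans (ℤ.+-identityʳ (+ m)) (trans (cong +_ m≡q*p) (pos-* q p))))

  ≡-mod⇒∣a-b : ∀ {a b} → a ≡ b mod p → + p ℤD.∣ a - b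
  ≡-mod⇒∣a-b (divides-diff p∣a-b) = Signed.∣⇒∣ᵤ p∣a-b

  ≡0-mod⇒∣ : ∀ {a} → a ≡ 0ℤ mod p → + p ℤD.∣ a
  ≡0-mod⇒∣ {a} a≡0 = subst (+ p ℤD.∣_) (ℤ.+-identityʳ a) (≡-mod⇒∣a-b a≡0)

≡-mod-setoid : ℕ → Setoid 0ℓ 0ℓ
≡-mod-setoid p = record
  { Carrier       = ℤ
  ; _≈_           = _≡_mod p
  ; isEquivalence = record { refl = ≡⇒≡-mod refl ; sym = ≡-mod-sym ; trans = ≡-mod-trans }
  }

module ≡-mod-Reasoning (p : ℕ) = SetoidReasoning (≡-mod-setoid p)

-- Fermat's little theorem and power sums

powerSum : ℕ → ℕ → ℤ
powerSum r N = ∑[ a < N ] ((+ a) ^ r)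

∑-binomial-powerSum : ∀ r N → ∑[ i < suc r ] (+ (suc r C i) * powerSum i N) ≡ (+ N) ^ suc r
∑-binomial-powerSum r zero    = ∑-zero (suc r) (λ i _ → ℤ.*-zeroʳ (+ (suc r C i)))
∑-binomial-powerSum r (suc N) = begin
  ∑[ i < suc r ] (+ (suc r C i) * (powerSum i N + (+ N) ^ i))
    ≡⟨ ∑-cong (suc r) (λ i _ → ℤ.*-distribˡ-+ (+ (suc r C i)) (powerSum i N) ((+ N) ^ i)) ⟩
  ∑[ i < suc r ] (+ (suc r C i) * powerSum i N + + (suc r C i) * (+ N) ^ i)
    ≡⟨ ∑-distrib-+ (suc r) _ _ ⟩
  ∑[ i < suc r ] (+ (suc r C i) * powerSum i N) + ∑[ i < suc r ] (+ (suc r C i) * (+ N) ^ i)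
    ≡⟨ cong (_+ ∑[ i < suc r ] (+ (suc r C i) * (+ N) ^ i)) (∑-binomial-powerSum r N) ⟩
  (+ N) ^ suc r + ∑[ i < suc r ] (+ (suc r C i) * (+ N) ^ i)
    ≡⟨ ℤ.+-comm ((+ N) ^ suc r) _ ⟩
  ∑[ i < suc r ] (+ (suc r C i) * (+ N) ^ i) + (+ N) ^ suc r
    ≡⟨ cong₂ _+_ (∑-cong (suc r) λ i _ → cong (+ (suc r C i) *_)
                   (trans (sym (ℤ.*-identityʳ ((+ N) ^ i))) (cong ((+ N) ^ i *_) (sym (ℤ.^-zeroˡ (suc r ∸ i))))))
                 (sym last-term) ⟩
  ∑[ i < suc (suc r) ] (+ (suc r C i) * ((+ N) ^ i * 1ℤ ^ (suc r ∸ i)))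
    ≡⟨ sym (binomial-theorem (suc r) (+ N) 1ℤ) ⟩
  (+ N + 1ℤ) ^ suc r
    ≡⟨ cong (_^ suc r) (trans (ℤ.+-comm (+ N) 1ℤ) (sym (pos-+ 1 N))) ⟩
  (+ suc N) ^ suc r ∎
  where
  open ≡-Reasoning
  last-term : + (suc r C suc r) * ((+ N) ^ suc r * 1ℤ ^ (suc r ∸ suc r)) ≡ (+ N) ^ suc r
  last-term = begin
    + (suc r C suc r) * ((+ N) ^ suc r * 1ℤ ^ (r ∸ r))
      ≡⟨ cong₂ (λ c k → + c * ((+ N) ^ suc r * 1ℤ ^ k)) (nCn≡1 (suc r)) (ℕ.n∸n≡0 r) ⟩
    1ℤ * ((+ N) ^ suc r * 1ℤ)
      ≡⟨ trans (ℤ.*-identityˡ _) (ℤ.*-identityʳ _) ⟩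
    (+ N) ^ suc r ∎

module _ {n : ℕ} (p-prime : Prime (suc n)) where

  *-cancelˡ-≡-mod : ∀ {a x y} → ¬ (suc n ∣ a) → + a * x ≡ + a * y mod suc n → x ≡ y mod suc n
  *-cancelˡ-≡-mod {a} {x} {y} p∤a (divides-diff p∣ax-ay)
    with euclidsLemma a ℤ.∣ x - y ∣ p-prime
           (subst (suc n ∣_) (ℤ.abs-* (+ a) (x - y))
             (Signed.∣⇒∣ᵤ (subst (+ suc n Signed.∣_) (sym (x[y-z]≈xy-xz (+ a) x y)) p∣ax-ay)))
  ... | inj₁ p∣a     = ⊥-elim (p∤a p∣a)
  ... | inj₂ p∣∣x-y∣ = divides-diff (Signed.∣ᵤ⇒∣ p∣∣x-y∣)

  p∣pC[1+k] : ∀ {k} → k < n → suc n ∣ suc n C suc k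
  p∣pC[1+k] {k} k<n
    with euclidsLemma (suc k) (suc n C suc k) p-prime
           (divides (n C k) (trans (sym ([1+n]*nCk≡[1+k]*[1+n]C[1+k] n k)) (ℕ.*-comm (suc n) (n C k))))
  ... | inj₁ p∣1+k = ⊥-elim (>⇒∤ (s≤s k<n) p∣1+k)
  ... | inj₂ p∣pCk = p∣pCk

  freshman's-dream : ∀ x y → (x + y) ^ suc n ≡ x ^ suc n + y ^ suc n mod suc n
  freshman's-dream x y = begin
    (x + y) ^ suc n
      ≡⟨ trans (binomial-theorem (suc n) x y) (∑-head (suc n) term) ⟩
    term 0 + (∑[ i < n ] term (suc i) + term (suc n))
      ≈⟨ +-congˡ-mod (term 0) (+-congʳ-mod (term (suc n)) (∑-cong-mod n middle≡0)) ⟩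
    term 0 + (∑[ i < n ] 0ℤ + term (suc n))
      ≡⟨ cong₂ (λ a b → a + (b + term (suc n))) first (∑-zero n (λ _ _ → refl)) ⟩
    y ^ suc n + (0ℤ + term (suc n))
      ≡⟨ cong (λ b → y ^ suc n + b) (trans (ℤ.+-identityˡ _) last) ⟩
    y ^ suc n + x ^ suc n
      ≡⟨ ℤ.+-comm (y ^ suc n) (x ^ suc n) ⟩
    x ^ suc n + y ^ suc n ∎
    where
    open ≡-mod-Reasoning (suc n)
    term : ℕ → ℤ
    term i = + (suc n C i) * (x ^ i * y ^ (suc n ∸ i))
    middle≡0 : ∀ i → i < n → term (suc i) ≡ 0ℤ mod suc n
    middle≡0 i i<n = *-congʳ-mod (x ^ suc i * y ^ (n ∸ i)) (∣⇒≡0-mod (p∣pC[1+k] i<n))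
    first : term 0 ≡ y ^ suc n
    first = trans (ℤ.*-identityˡ _) (ℤ.*-identityˡ _)
    last : term (suc n) ≡ x ^ suc n
    last = trans (cong₂ (λ c k → + c * (x ^ suc n * y ^ k)) (nCn≡1 (suc n)) (ℕ.n∸n≡0 n))
                 (trans (ℤ.*-identityˡ (x ^ suc n * 1ℤ)) (ℤ.*-identityʳ (x ^ suc n)))

  fermat : ∀ a → (+ a) ^ suc n ≡ + a mod suc n
  fermat zero    = ≡⇒≡-mod refl
  fermat (suc a) = begin
    (+ suc a) ^ suc n           ≡⟨ cong (_^ suc n) (pos-+ 1 a) ⟩
    (1ℤ + + a) ^ suc n          ≈⟨ freshman's-dream 1ℤ (+ a) ⟩
    1ℤ ^ suc n + (+ a) ^ suc n  ≈⟨ +-cong-mod (≡⇒≡-mod (ℤ.^-zeroˡ (suc n))) (fermat a) ⟩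
    1ℤ + + a                    ≡⟨ sym (pos-+ 1 a) ⟩
    + suc a                     ∎
    where open ≡-mod-Reasoning (suc n)

  fermat-little : ∀ {a} → 0 < a → a < suc n → (+ a) ^ n ≡ 1ℤ mod suc n
  fermat-little {suc a} _ a<p = *-cancelˡ-≡-mod (>⇒∤ a<p) (begin
    + suc a * (+ suc a) ^ n  ≈⟨ fermat (suc a) ⟩
    + suc a                  ≡⟨ sym (ℤ.*-identityʳ (+ suc a)) ⟩
    + suc a * 1ℤ             ∎)
    where open ≡-mod-Reasoning (suc n)

  powerSum-vanish : ∀ r → r < n → powerSum r (suc n) ≡ 0ℤ mod suc n
  powerSum-vanish = <-rec _ step
    where
    open ≡-mod-Reasoning (suc n)
    step : ∀ r → (∀ {i} → i < r → i < n → powerSum i (suc n) ≡ 0ℤ mod suc n) →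
           r < n → powerSum r (suc n) ≡ 0ℤ mod suc n
    step r rec r<n = *-cancelˡ-≡-mod (>⇒∤ (s≤s r<n)) (begin
      + suc r * powerSum r (suc n)
        ≡⟨ cong (λ c → + c * powerSum r (suc n)) (sym [1+r]C[r]≡1+r) ⟩
      + (suc r C r) * powerSum r (suc n)
        ≡⟨ sym (ℤ.+-identityˡ _) ⟩
      0ℤ + + (suc r C r) * powerSum r (suc n)
        ≈⟨ +-congʳ-mod (+ (suc r C r) * powerSum r (suc n)) (≡-mod-sym lower-terms) ⟩
      ∑[ i < suc r ] (+ (suc r C i) * powerSum i (suc n))
        ≡⟨ ∑-binomial-powerSum r (suc n) ⟩
      (+ suc n) ^ suc r
        ≈⟨ *-congʳ-mod ((+ suc n) ^ r) (∣⇒≡0-mod (ℕD.∣-refl {suc n})) ⟩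
      0ℤ
        ≡⟨ sym (ℤ.*-zeroʳ (+ suc r)) ⟩
      + suc r * 0ℤ ∎)
      where
      [1+r]C[r]≡1+r : suc r C r ≡ suc r
      [1+r]C[r]≡1+r =
        trans (nCk≡nC[n∸k] (ℕ.n≤1+n r)) (trans (cong (suc r C_) (ℕ.m+n∸n≡m 1 r)) (nC1≡n (suc r)))
      lower-terms : ∑[ i < r ] (+ (suc r C i) * powerSum i (suc n)) ≡ 0ℤ mod suc n
      lower-terms = begin
        ∑[ i < r ] (+ (suc r C i) * powerSum i (suc n))
          ≈⟨ ∑-cong-mod r (λ i i<r → *-congˡ-mod (+ (suc r C i)) (rec i<r (ℕ.<-trans i<r r<n))) ⟩
        ∑[ i < r ] (+ (suc r C i) * 0ℤ)
          ≡⟨ ∑-zero r (λ i _ → ℤ.*-zeroʳ (+ (suc r C i))) ⟩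
        0ℤ ∎

-- C^{(-k-1)}_{p-2} modulo p

[1+j]*expNegPowℤ : ∀ j n → + suc j * expNegPowℤ j n ≡
                   -1ℤ ^ n * ∑[ i < suc j ] (-1ℤ ^ i * + (suc j C suc i) * (+ suc i) ^ suc n)
[1+j]*expNegPowℤ j n = begin
  + suc j * expNegPowℤ j n
    ≡⟨ *-distribˡ-∑ (suc j) (+ suc j) _ ⟩
  ∑[ i < suc j ] (+ suc j * (signedBinomial j i * exp (-1ℤ - + i) n))
    ≡⟨ ∑-cong (suc j) (λ i _ → absorb i) ⟩
  ∑[ i < suc j ] (-1ℤ ^ n * (-1ℤ ^ i * + (suc j C suc i) * (+ suc i) ^ suc n))
    ≡⟨ sym (*-distribˡ-∑ (suc j) (-1ℤ ^ n) _) ⟩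
  -1ℤ ^ n * ∑[ i < suc j ] (-1ℤ ^ i * + (suc j C suc i) * (+ suc i) ^ suc n) ∎
  where
  open ≡-Reasoning
  regroup : ∀ s σ c μ τ → s * (σ * c * (μ * τ)) ≡ μ * (σ * (s * c) * τ)
  regroup = solve-∀
  reassoc : ∀ σ c a t → σ * (c * a) * t ≡ σ * c * (a * t)
  reassoc = solve-∀
  pos-absorption : ∀ i → + suc j * + (j C i) ≡ + (suc j C suc i) * + suc i
  pos-absorption i = begin
    + suc j * + (j C i)           ≡⟨ sym (pos-* (suc j) (j C i)) ⟩
    + (suc j ℕ.* (j C i))         ≡⟨ cong +_ ([1+n]*nCk≡[1+k]*[1+n]C[1+k] j i) ⟩
    + (suc i ℕ.* (suc j C suc i)) ≡⟨ pos-* (suc i) (suc j C suc i) ⟩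
    + suc i * + (suc j C suc i)   ≡⟨ ℤ.*-comm (+ suc i) _ ⟩
    + (suc j C suc i) * + suc i   ∎
  absorb : ∀ i → + suc j * (signedBinomial j i * exp (-1ℤ - + i) n) ≡
                 -1ℤ ^ n * (-1ℤ ^ i * + (suc j C suc i) * (+ suc i) ^ suc n)
  absorb i = begin
    + suc j * (-1ℤ ^ i * + (j C i) * (-1ℤ - + i) ^ n)
      ≡⟨ cong (λ x → + suc j * (-1ℤ ^ i * + (j C i) * x ^ n))
              (trans (-1-i≡-[1+i] i) (sym (ℤ.-1*i≡-i (+ suc i)))) ⟩
    + suc j * (-1ℤ ^ i * + (j C i) * (-1ℤ * + suc i) ^ n)
      ≡⟨ cong (λ x → + suc j * (-1ℤ ^ i * + (j C i) * x)) (^-distrib-* -1ℤ (+ suc i) n) ⟩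
    + suc j * (-1ℤ ^ i * + (j C i) * (-1ℤ ^ n * (+ suc i) ^ n))
      ≡⟨ regroup (+ suc j) (-1ℤ ^ i) (+ (j C i)) (-1ℤ ^ n) ((+ suc i) ^ n) ⟩
    -1ℤ ^ n * (-1ℤ ^ i * (+ suc j * + (j C i)) * (+ suc i) ^ n)
      ≡⟨ cong (λ c → -1ℤ ^ n * (-1ℤ ^ i * c * (+ suc i) ^ n)) (pos-absorption i) ⟩
    -1ℤ ^ n * (-1ℤ ^ i * (+ (suc j C suc i) * + suc i) * (+ suc i) ^ n)
      ≡⟨ cong (-1ℤ ^ n *_) (reassoc (-1ℤ ^ i) (+ (suc j C suc i)) (+ suc i) ((+ suc i) ^ n)) ⟩
    -1ℤ ^ n * (-1ℤ ^ i * + (suc j C suc i) * (+ suc i) ^ suc n) ∎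

∑-1≡+ : ∀ m → ∑[ i < m ] 1ℤ ≡ + m
∑-1≡+ zero    = refl
∑-1≡+ (suc m) = trans (cong (_+ 1ℤ) (∑-1≡+ m)) (trans (ℤ.+-comm (+ m) 1ℤ) (sym (pos-+ 1 m)))

module _ {n : ℕ} (p-prime : Prime (suc (suc n))) where

  -1≡p-1 : -1ℤ ≡ + suc n mod suc (suc n)
  -1≡p-1 = divides-diff (Signed.divides -1ℤ (sym (ℤ.-1*i≡-i (+ (suc (suc n))))))

  [1+j]*expNegPowℤ≡-mod : ∀ {j} → j ≤ n → + suc j * expNegPowℤ j n ≡ -1ℤ ^ n mod suc (suc n)
  [1+j]*expNegPowℤ≡-mod {j} j≤n = begin
    + suc j * expNegPowℤ j n
      ≡⟨ [1+j]*expNegPowℤ j n ⟩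
    -1ℤ ^ n * ∑[ i < suc j ] (-1ℤ ^ i * + (suc j C suc i) * (+ suc i) ^ suc n)
      ≈⟨ *-congˡ-mod (-1ℤ ^ n) (∑-cong-mod (suc j) λ i i<1+j → *-congˡ-mod (-1ℤ ^ i * + (suc j C suc i))
           (fermat-little p-prime (s≤s z≤n) (s≤s (s≤s (ℕ.≤-trans (ℕ.m<1+n⇒m≤n i<1+j) j≤n))))) ⟩
    -1ℤ ^ n * ∑[ i < suc j ] (-1ℤ ^ i * + (suc j C suc i) * 1ℤ)
      ≡⟨ cong (-1ℤ ^ n *_) (trans (∑-cong (suc j) λ i _ → ℤ.*-identityʳ _) (alternating-binomial-sum j)) ⟩
    -1ℤ ^ n * 1ℤ
      ≡⟨ ℤ.*-identityʳ (-1ℤ ^ n) ⟩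
    -1ℤ ^ n ∎
    where open ≡-mod-Reasoning (suc (suc n))

  polyBernℤ≡-mod : ∀ k → polyBernℤ (suc k) n ≡ -1ℤ ^ n * ∑[ j < suc n ] ((+ suc j) ^ k) mod suc (suc n)
  polyBernℤ≡-mod k = begin
    ∑[ j < suc n ] (+ (suc j ℕ.^ suc k) * expNegPowℤ j n)
      ≡⟨ ∑-cong (suc n) (λ j _ → split j) ⟩
    ∑[ j < suc n ] ((+ suc j) ^ k * (+ suc j * expNegPowℤ j n))
      ≈⟨ ∑-cong-mod (suc n) (λ j j<1+n → *-congˡ-mod ((+ suc j) ^ k) ([1+j]*expNegPowℤ≡-mod (ℕ.m<1+n⇒m≤n j<1+n))) ⟩
    ∑[ j < suc n ] ((+ suc j) ^ k * -1ℤ ^ n)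
      ≡⟨ trans (∑-cong (suc n) λ j _ → ℤ.*-comm ((+ suc j) ^ k) (-1ℤ ^ n)) (sym (*-distribˡ-∑ (suc n) (-1ℤ ^ n) _)) ⟩
    -1ℤ ^ n * ∑[ j < suc n ] ((+ suc j) ^ k) ∎
    where
    open ≡-mod-Reasoning (suc (suc n))
    split : ∀ j → + (suc j ℕ.^ suc k) * expNegPowℤ j n ≡ (+ suc j) ^ k * (+ suc j * expNegPowℤ j n)
    split j = trans (cong (_* expNegPowℤ j n) (pos-^ (suc j) (suc k)))
                    (rearrange (+ suc j) ((+ suc j) ^ k) (expNegPowℤ j n))
      where
      rearrange : ∀ a b c → a * b * c ≡ b * (a * c)
      rearrange = solve-∀

  [1+j]^[r+q[p-1]]≡-mod : ∀ {j} r q → j ≤ n → (+ suc j) ^ (r ℕ.+ q ℕ.* suc n) ≡ (+ suc j) ^ r mod suc (suc n)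
  [1+j]^[r+q[p-1]]≡-mod {j} r q j≤n = begin
    (+ suc j) ^ (r ℕ.+ q ℕ.* suc n)
      ≡⟨ ℤ.^-distribˡ-+-* (+ suc j) r (q ℕ.* suc n) ⟩
    (+ suc j) ^ r * (+ suc j) ^ (q ℕ.* suc n)
      ≡⟨ cong (λ e → (+ suc j) ^ r * (+ suc j) ^ e) (ℕ.*-comm q (suc n)) ⟩
    (+ suc j) ^ r * (+ suc j) ^ (suc n ℕ.* q)
      ≡⟨ cong ((+ suc j) ^ r *_) (sym (ℤ.^-*-assoc (+ suc j) (suc n) q)) ⟩
    (+ suc j) ^ r * ((+ suc j) ^ suc n) ^ q
      ≈⟨ *-congˡ-mod ((+ suc j) ^ r) (^-cong-mod (fermat-little p-prime (s≤s z≤n) (s≤s (s≤s j≤n))) q) ⟩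
    (+ suc j) ^ r * 1ℤ ^ q
      ≡⟨ trans (cong ((+ suc j) ^ r *_) (ℤ.^-zeroˡ q)) (ℤ.*-identityʳ _) ⟩
    (+ suc j) ^ r ∎
    where open ≡-mod-Reasoning (suc (suc n))

  ∑-powers≡-mod-divisible : ∀ {k} → suc n ∣ k → ∑[ j < suc n ] ((+ suc j) ^ k) ≡ + suc n mod suc (suc n)
  ∑-powers≡-mod-divisible (divides q refl) = begin
    ∑[ j < suc n ] ((+ suc j) ^ (q ℕ.* suc n))
      ≈⟨ ∑-cong-mod (suc n) (λ j j<1+n → [1+j]^[r+q[p-1]]≡-mod 0 q (ℕ.m<1+n⇒m≤n j<1+n)) ⟩
    ∑[ j < suc n ] 1ℤ
      ≡⟨ ∑-1≡+ (suc n) ⟩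
    + suc n ∎
    where open ≡-mod-Reasoning (suc (suc n))

  ∑-powers≡-mod-nondivisible : ∀ {k} → ¬ (suc n ∣ k) → ∑[ j < suc n ] ((+ suc j) ^ k) ≡ 0ℤ mod suc (suc n)
  ∑-powers≡-mod-nondivisible {k} p-1∤k
    with k ℕ.% suc n | ℕ.m≡m%n+[m/n]*n k (suc n) | ℕ.m%n<n k (suc n)
  ... | zero  | k≡q*[p-1] | _   = ⊥-elim (p-1∤k (divides (k ℕ./ suc n) k≡q*[p-1]))
  ... | suc r | k≡r+q*[p-1] | r<n = begin
    ∑[ j < suc n ] ((+ suc j) ^ k)
      ≡⟨ cong (λ e → ∑[ j < suc n ] ((+ suc j) ^ e)) k≡r+q*[p-1] ⟩
    ∑[ j < suc n ] ((+ suc j) ^ (suc r ℕ.+ k ℕ./ suc n ℕ.* suc n))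
      ≈⟨ ∑-cong-mod (suc n) (λ j j<1+n → [1+j]^[r+q[p-1]]≡-mod (suc r) (k ℕ./ suc n) (ℕ.m<1+n⇒m≤n j<1+n)) ⟩
    ∑[ j < suc n ] ((+ suc j) ^ suc r)
      ≡⟨ sym (trans (∑-head (suc n) (λ a → (+ a) ^ suc r)) (ℤ.+-identityˡ _)) ⟩
    powerSum (suc r) (suc (suc n))
      ≈⟨ powerSum-vanish p-prime (suc r) r<n ⟩
    0ℤ ∎
    where open ≡-mod-Reasoning (suc (suc n))

  polyBernℤ≡1-mod : ∀ {k} → suc n ∣ k → polyBernℤ (suc k) n ≡ 1ℤ mod suc (suc n)
  polyBernℤ≡1-mod {k} p-1∣k = begin
    polyBernℤ (suc k) n                        ≈⟨ polyBernℤ≡-mod k ⟩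
    -1ℤ ^ n * ∑[ j < suc n ] ((+ suc j) ^ k)   ≈⟨ *-congˡ-mod (-1ℤ ^ n) (∑-powers≡-mod-divisible p-1∣k) ⟩
    -1ℤ ^ n * + suc n                          ≈⟨ *-congʳ-mod (+ suc n) (^-cong-mod -1≡p-1 n) ⟩
    (+ suc n) ^ n * + suc n                    ≡⟨ ℤ.*-comm ((+ suc n) ^ n) (+ suc n) ⟩
    (+ suc n) ^ suc n                          ≈⟨ fermat-little p-prime (s≤s z≤n) ℕ.≤-refl ⟩
    1ℤ                                         ∎
    where open ≡-mod-Reasoning (suc (suc n))

  polyBernℤ≡0-mod : ∀ {k} → ¬ (suc n ∣ k) → polyBernℤ (suc k) n ≡ 0ℤ mod suc (suc n)
  polyBernℤ≡0-mod {k} p-1∤k = begin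
    polyBernℤ (suc k) n                        ≈⟨ polyBernℤ≡-mod k ⟩
    -1ℤ ^ n * ∑[ j < suc n ] ((+ suc j) ^ k)   ≈⟨ *-congˡ-mod (-1ℤ ^ n) (∑-powers≡-mod-nondivisible p-1∤k) ⟩
    -1ℤ ^ n * 0ℤ                               ≡⟨ ℤ.*-zeroʳ (-1ℤ ^ n) ⟩
    0ℤ                                         ∎
    where open ≡-mod-Reasoning (suc (suc n))

theorem3p2 : (p : ℕ) → Prime p → p ≢ 2 → (k : ℕ) →
    ∃[ c ] (polyBernC⁻ (suc k) (p ∸ 2) ≡ c / 1
    × (¬ ((p ∸ 1) ℕD.∣ k) → (+ p) ℤD.∣ c)
    × ((p ∸ 1) ℕD.∣ k → (+ p) ℤD.∣ (c - + 1)))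
theorem3p2 0             p-prime = ⊥-elim (¬prime[0] p-prime)
theorem3p2 1             p-prime = ⊥-elim (¬prime[1] p-prime)
theorem3p2 (suc (suc n)) p-prime _ k =
  polyBernℤ (suc k) n , polyBernC⁻≡polyBernℤ (suc k) n ,
  (λ p-1∤k → ≡0-mod⇒∣ (polyBernℤ≡0-mod p-prime p-1∤k)) ,
  (λ p-1∣k → ≡-mod⇒∣a-b (polyBernℤ≡1-mod p-prime p-1∣k))
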